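{- Let $d\in\mathbb{N}$ and let $D_1$ be a maximal independent set of the Andrásfai graph $\Gamma_d$. Then $\Gamma_d$ admits a proper $3$-coloring $\{D_1,D_2,D_3\}$ (a partition of $V(\Gamma_d)$ into three independent sets, one of which is $D_1$) such that the complement graph $\overline{\Gamma_d}$ restricted to $D_2\cup D_3$, namely $\overline{\Gamma_d}[D_2\cup D_3]$, has no induced cycle of length $4$.
   Context: For $d\in\mathbb{N}$, the Andrásfai graph $\Gamma_d$ has vertex set $[3d-1]=\{1,\dots,3d-1\}$ and edge set $\{xy : y = x+i \text{ for some } i\in\{d,d+1,\dots,2d-1\}\}$, with arithmetic modulo $3d-1$. For a graph $H$, $\overline{H}$ denotes its complement and $H[S]$ the subgraph induced by $S\subseteq V(H)$. -}

module Defs where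

open import Data.Nat using (ℕ; zero; suc; _+_; _*_; _∸_; _≤_; _<_; _≤ᵇ_)
open import Data.Bool using (if_then_else_)
open import Data.Fin using (Fin; toℕ)
open import Data.Fin.Subset using (Subset; _∈_; _∉_; _⊆_)
open import Data.Product using (_×_; ∃-syntax)
open import Data.Sum using (_⊎_)
open import Relation.Binary.PropositionalEquality using (_≡_; _≢_)
open import Relation.Nullary using (¬_)

-- Number of vertices of the Andrásfai graph Γ_d : 3d - 1.
-- Vertex k ∈ Fin (3d-1) represents the residue k mod (3d-1)
-- (the paper's vertex 3d-1 is the residue 0).
andrasfaiN : ℕ → ℕ
andrasfaiN d = 3 * d ∸ 1

modDiff : (n : ℕ) → ℕ → ℕ → ℕ
modDiff n x y = if x ≤ᵇ y then y ∸ x else (y + n) ∸ x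

AndrasfaiAdj : (d : ℕ) → Fin (andrasfaiN d) → Fin (andrasfaiN d) → Set
AndrasfaiAdj d x y =
  d ≤ modDiff (andrasfaiN d) (toℕ x) (toℕ y) × modDiff (andrasfaiN d) (toℕ x) (toℕ y) < 2 * d

ComplAdj : {n : ℕ} → (Fin n → Fin n → Set) → Fin n → Fin n → Set
ComplAdj E x y = x ≢ y × ¬ E x y

Independent : {n : ℕ} → (Fin n → Fin n → Set) → Subset n → Set
Independent E S = ∀ x y → x ∈ S → y ∈ S → ¬ E x y

MaximalIndependent : {n : ℕ} → (Fin n → Fin n → Set) → Subset n → Set
MaximalIndependent {n} E S =
  Independent E S × (∀ (T : Subset n) → Independent E T → S ⊆ T → T ⊆ S)

Partition3 : {n : ℕ} → Subset n → Subset n → Subset n → Set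
Partition3 {n} A B C =
  ∀ (x : Fin n) →
    (x ∈ A × x ∉ B × x ∉ C) ⊎ (x ∉ A × x ∈ B × x ∉ C) ⊎ (x ∉ A × x ∉ B × x ∈ C)

Proper3Coloring : {n : ℕ} → (Fin n → Fin n → Set) → Subset n → Subset n → Subset n → Set
Proper3Coloring E A B C = Partition3 A B C × Independent E A × Independent E B × Independent E C

HasInducedC4 : {n : ℕ} → (Fin n → Fin n → Set) → Subset n → Set
HasInducedC4 E S =
  ∃[ a ] ∃[ b ] ∃[ c ] ∃[ e ]
    (a ∈ S × b ∈ S × c ∈ S × e ∈ S) ×
    (a ≢ b × a ≢ c × a ≢ e × b ≢ c × b ≢ e × c ≢ e) ×
    (E a b × E b c × E c e × E e a) ×
    (¬ E a c × ¬ E b e)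

-- Write n = 3d - 1 and let offset a x ∈ [0, n) be the number of steps from a to x around
-- the cycle ℤ/n, so that x ~ y iff offset x y ∈ [d, 2d). Offsets from a common anchor
-- subtract (offset x y = offset a y - offset a x when offset a x ≤ offset a y), hence any
-- arc of d consecutive vertices is independent. Conversely let D₁ be independent and p ∈ D₁.
-- Seen from the vertex q lying d - 1 steps before p, the non-neighbours of p occupy the
-- offsets [0, 2d - 1), so all of D₁ does; if a ∈ D₁ has least offset from q, every y ∈ D₁
-- then satisfies offset a y < 2d, and non-adjacency forces offset a y < d. So a maximal D₁
-- is the arc [a, a + d), and the arcs [a + d, a + 2d) and [a + 2d, a + n) complete a proper
-- 3-colouring. On their union, of length 2d - 1, complement adjacency means that offsets
-- from a differ by less than d: the neighbours above any vertex form a clique, and an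
-- induced 4-cycle is impossible at its lowest vertex.
{-# OPTIONS --safe #-}
module Submission where

open import Defs
open import Data.Bool using (true; false)
open import Data.Fin using (Fin; toℕ; fromℕ<)
open import Data.Fin.Properties using (toℕ<n; toℕ-fromℕ<; toℕ-injective)
open import Data.Fin.Subset using (Subset; _∈_; _∉_; _⊆_; _∪_; ⁅_⁆; Nonempty)
open import Data.Fin.Subset.Properties using (_∈?_; nonempty?; ⊆-antisym; x∈p∪q⁻; x∈⁅x⁆; x∈⁅y⁆⇒x≡y)
open import Data.List using (filter; allFin)
open import Data.List.Membership.Propositional.Properties using (∈-filter⁺; ∈-allFin)
open import Data.List.Relation.Unary.All as All using ()
open import Data.List.Relation.Unary.All.Properties using (all-filter)
open import Data.Nat using (ℕ; suc; _+_; _*_; _∸_; _≤_; _<_; _≤ᵇ_; z≤n; z<s; s≤s⁻¹; NonZero; >-nonZero)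
open import Data.Nat.Properties
open import Data.List.Extrema ≤-totalOrder using (argmin; argmin-all; f[argmin]≤f[xs])
open import Data.Nat.DivMod using (_%_; %-distribˡ-+; m%n%n≡m%n; [m+n]%n≡m%n; m<n⇒m%n≡m; m≤n⇒[n∸m]%m≡n%m; m%n<n)
open import Data.Product using (_×_; _,_; proj₁; proj₂; ∃-syntax)
open import Data.Sum using (_⊎_; inj₁; inj₂)
open import Data.Vec using (tabulate)
open import Data.Vec.Properties using (lookup∘tabulate; lookup⇒[]=; []=⇒lookup)
open import Function using (_∘_)
open import Relation.Binary.Definitions using (tri<; tri≈; tri>)
open import Relation.Binary.PropositionalEquality
open import Relation.Nullary using (¬_; yes; no; does; contradiction; ofʸ; ofⁿ)
open import Relation.Nullary.Decidable using (dec-true; _×-dec_)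
open import Relation.Unary using (Pred; Decidable)

[m+n%o]%o≡[m+n]%o : ∀ m n o .{{_ : NonZero o}} → (m + n % o) % o ≡ (m + n) % o
[m+n%o]%o≡[m+n]%o m n o = begin
  (m + n % o) % o         ≡⟨ %-distribˡ-+ m (n % o) o ⟩
  (m % o + n % o % o) % o ≡⟨ cong (λ k → (m % o + k) % o) (m%n%n≡m%n n o) ⟩
  (m % o + n % o) % o     ≡⟨ %-distribˡ-+ m n o ⟨
  (m + n) % o             ∎
  where open ≡-Reasoning

module _ {n : ℕ} .{{_ : NonZero n}} where

  modDiff-≤ : ∀ {x y} → x ≤ y → modDiff n x y ≡ y ∸ x
  modDiff-≤ {x} {y} x≤y with x ≤ᵇ y | ≤ᵇ-reflects-≤ x y
  ... | true  | _        = refl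
  ... | _     | ofⁿ x≰y = contradiction x≤y x≰y

  modDiff-> : ∀ {x y} → y < x → modDiff n x y ≡ y + n ∸ x
  modDiff-> {x} {y} y<x with x ≤ᵇ y | ≤ᵇ-reflects-≤ x y
  ... | _     | ofʸ x≤y = contradiction x≤y (<⇒≱ y<x)
  ... | false | _        = refl

  modDiff-< : ∀ {x y} → y < n → modDiff n x y < n
  modDiff-< {x} {y} y<n with x ≤? y
  ... | yes x≤y rewrite modDiff-≤ x≤y = ≤-<-trans (m∸n≤m y x) y<n
  ... | no  x≰y rewrite modDiff-> (≰⇒> x≰y) = m<n+o⇒m∸n<o (y + n) x (+-monoˡ-< n (≰⇒> x≰y))

  modDiff-self : ∀ x → modDiff n x x ≡ 0
  modDiff-self x = trans (modDiff-≤ {x = x} ≤-refl) (n∸n≡0 x)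

  modDiff-spec : ∀ {x y} → x < n → y < n → (modDiff n x y + x) % n ≡ y
  modDiff-spec {x} {y} x<n y<n with x ≤? y
  ... | yes x≤y rewrite modDiff-≤ x≤y | m∸n+n≡m x≤y = m<n⇒m%n≡m y<n
  ... | no  x≰y rewrite modDiff-> (≰⇒> x≰y) | m∸n+n≡m (≤-trans (<⇒≤ x<n) (m≤n+m n y)) =
    trans ([m+n]%n≡m%n y n) (m<n⇒m%n≡m y<n)

  modDiff-unique : ∀ {x y m} → x < n → m < n → (m + x) % n ≡ y → modDiff n x y ≡ m
  modDiff-unique {x} {_} {m} x<n m<n refl with m + x <? n
  ... | yes m+x<n rewrite m<n⇒m%n≡m m+x<n = trans (modDiff-≤ (m≤n+m x m)) (m+n∸n≡m m x)
  ... | no  m+x≮n = begin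
    modDiff n x ((m + x) % n) ≡⟨ cong (modDiff n x) [m+x]%n≡r ⟩
    modDiff n x r             ≡⟨ modDiff-> r<x ⟩
    r + n ∸ x                 ≡⟨ cong (_∸ x) (m∸n+n≡m n≤m+x) ⟩
    m + x ∸ x                 ≡⟨ m+n∸n≡m m x ⟩
    m                         ∎
    where
    open ≡-Reasoning
    n≤m+x = ≮⇒≥ m+x≮n
    r = m + x ∸ n
    r<x : r < x
    r<x = subst (r <_) (m+n∸m≡n n x) (∸-monoˡ-< (+-monoˡ-< x m<n) n≤m+x)
    [m+x]%n≡r : (m + x) % n ≡ r
    [m+x]%n≡r = trans (sym (m≤n⇒[n∸m]%m≡n%m n≤m+x)) (m<n⇒m%n≡m (<-trans r<x x<n))

  modDiff-relative : ∀ {q x y} → q < n → x < n → y < n → modDiff n q x ≤ modDiff n q y →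
                     modDiff n x y ≡ modDiff n q y ∸ modDiff n q x
  modDiff-relative {q} {x} {y} q<n x<n y<n qx≤qy =
    modDiff-unique x<n (≤-<-trans (m∸n≤m qy qx) (modDiff-< {x = q} y<n)) (begin
      (qy ∸ qx + x) % n            ≡⟨ cong (λ k → (qy ∸ qx + k) % n) (modDiff-spec q<n x<n) ⟨
      (qy ∸ qx + (qx + q) % n) % n ≡⟨ [m+n%o]%o≡[m+n]%o (qy ∸ qx) (qx + q) n ⟩
      (qy ∸ qx + (qx + q)) % n     ≡⟨ cong (_% n) (+-assoc (qy ∸ qx) qx q) ⟨
      (qy ∸ qx + qx + q) % n       ≡⟨ cong (λ k → (k + q) % n) (m∸n+n≡m qx≤qy) ⟩
      (qy + q) % n                 ≡⟨ modDiff-spec q<n y<n ⟩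
      y                            ∎)
    where
    open ≡-Reasoning
    qx = modDiff n q x
    qy = modDiff n q y

  modDiff-+-swap-< : ∀ {x y} → x < y → y < n → modDiff n x y + modDiff n y x ≡ n
  modDiff-+-swap-< {x} {y} x<y y<n = begin
    modDiff n x y + modDiff n y x ≡⟨ cong₂ _+_ (modDiff-≤ (<⇒≤ x<y)) (modDiff-> x<y) ⟩
    y ∸ x + (x + n ∸ y)           ≡⟨ +-∸-assoc (y ∸ x) (≤-trans (<⇒≤ y<n) (m≤n+m n x)) ⟨
    y ∸ x + (x + n) ∸ y           ≡⟨ cong (_∸ y) (+-assoc (y ∸ x) x n) ⟨
    y ∸ x + x + n ∸ y             ≡⟨ cong (λ k → k + n ∸ y) (m∸n+n≡m (<⇒≤ x<y)) ⟩
    y + n ∸ y                     ≡⟨ m+n∸m≡n y n ⟩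
    n                             ∎
    where open ≡-Reasoning

  modDiff-+-swap : ∀ {x y} → x < n → y < n → x ≢ y → modDiff n x y + modDiff n y x ≡ n
  modDiff-+-swap {x} {y} x<n y<n x≢y with <-cmp x y
  ... | tri< x<y _ _ = modDiff-+-swap-< x<y y<n
  ... | tri≈ _ x≡y _ = contradiction x≡y x≢y
  ... | tri> _ _ y<x = trans (+-comm (modDiff n x y) _) (modDiff-+-swap-< y<x x<n)

module _ {n : ℕ} {p} {P : Pred (Fin n) p} (P? : Decidable P) where

  ∈-tabulate⁺ : ∀ {x} → P x → x ∈ tabulate (does ∘ P?)
  ∈-tabulate⁺ {x} px = lookup⇒[]= x _ (trans (lookup∘tabulate (does ∘ P?) x) (dec-true (P? x) px))

  ∈-tabulate⁻ : ∀ {x} → x ∈ tabulate (does ∘ P?) → P x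
  ∈-tabulate⁻ {x} x∈ with P? x | trans (sym ([]=⇒lookup x∈)) (lookup∘tabulate (does ∘ P?) x)
  ... | yes px | _ = px
  ... | no  _  | ()

module _ {n : ℕ} where

  ∃-minimiser : ∀ (S : Subset n) (f : Fin n → ℕ) {p} → p ∈ S →
                ∃[ a ] a ∈ S × (∀ {y} → y ∈ S → f a ≤ f y)
  ∃-minimiser S f {p} p∈S =
    argmin f p xs ,
    argmin-all f p∈S (all-filter (_∈? S) (allFin n)) ,
    λ {y} y∈S → All.lookup (f[argmin]≤f[xs] p xs) (∈-filter⁺ (_∈? S) (∈-allFin y) y∈S)
    where xs = filter (_∈? S) (allFin n)

  maximalIndependent⇒nonempty : ∀ {E : Fin n → Fin n → Set} {S} → (∀ x → ¬ E x x) → Fin n →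
                                MaximalIndependent E S → Nonempty S
  maximalIndependent⇒nonempty {E} {S} irreflexive v (_ , maximal) with nonempty? S
  ... | yes nonempty = nonempty
  ... | no  empty    =
    v , maximal ⁅ v ⁆ singleton-independent (λ x∈S → contradiction (_ , x∈S) empty) (x∈⁅x⁆ v)
    where
    singleton-independent : Independent E ⁅ v ⁆
    singleton-independent x y x∈ y∈ rewrite x∈⁅y⁆⇒x≡y v x∈ | x∈⁅y⁆⇒x≡y v y∈ = irreflexive v

cycle4-localMin : ∀ (w x y z : ℕ) →
                  (w ≤ x × w ≤ z) ⊎ (x ≤ y × x ≤ w) ⊎ (y ≤ z × y ≤ x) ⊎ (z ≤ w × z ≤ y)
cycle4-localMin w x y z with ≤-total w y | ≤-total x z
... | inj₁ w≤y | inj₁ x≤z with ≤-total w x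
...   | inj₁ w≤x = inj₁ (w≤x , ≤-trans w≤x x≤z)
...   | inj₂ x≤w = inj₂ (inj₁ (≤-trans x≤w w≤y , x≤w))
cycle4-localMin w x y z | inj₁ w≤y | inj₂ z≤x with ≤-total w z
...   | inj₁ w≤z = inj₁ (≤-trans w≤z z≤x , w≤z)
...   | inj₂ z≤w = inj₂ (inj₂ (inj₂ (z≤w , ≤-trans z≤w w≤y)))
cycle4-localMin w x y z | inj₂ y≤w | inj₁ x≤z with ≤-total y x
...   | inj₁ y≤x = inj₂ (inj₂ (inj₁ (≤-trans y≤x x≤z , y≤x)))
...   | inj₂ x≤y = inj₂ (inj₁ (x≤y , ≤-trans x≤y y≤w))
cycle4-localMin w x y z | inj₂ y≤w | inj₂ z≤x with ≤-total y z
...   | inj₁ y≤z = inj₂ (inj₂ (inj₁ (y≤z , ≤-trans y≤z z≤x)))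
...   | inj₂ z≤y = inj₂ (inj₂ (inj₂ (≤-trans z≤y y≤w , z≤y)))

module _ {n : ℕ} where

  UpperNeighbourhoodsAreCliques : (Fin n → Fin n → Set) → Subset n → (Fin n → ℕ) → Set
  UpperNeighbourhoodsAreCliques E S f =
    ∀ {m v z} → m ∈ S → E m v → E m z → f m ≤ f v → f m ≤ f z → v ≢ z → E v z

  upperCliques⇒¬HasInducedC4 : ∀ {E S f} → (∀ {x y} → E x y → E y x) →
                               UpperNeighbourhoodsAreCliques E S f → ¬ HasInducedC4 E S
  upperCliques⇒¬HasInducedC4 {f = f} E-sym cliques
    (a , b , c , e , (a∈ , b∈ , c∈ , e∈) , (_ , a≢c , _ , _ , b≢e , _) , (ab , bc , ce , ea) , (¬ac , ¬be))
    with cycle4-localMin (f a) (f b) (f c) (f e)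
  ... | inj₁ (a≤b , a≤e)               = ¬be (cliques a∈ ab (E-sym ea) a≤b a≤e b≢e)
  ... | inj₂ (inj₁ (b≤c , b≤a))        = ¬ac (cliques b∈ (E-sym ab) bc b≤a b≤c a≢c)
  ... | inj₂ (inj₂ (inj₁ (c≤e , c≤b))) = ¬be (cliques c∈ (E-sym bc) ce c≤b c≤e b≢e)
  ... | inj₂ (inj₂ (inj₂ (e≤a , e≤c))) = ¬ac (cliques e∈ ea (E-sym ce) e≤a e≤c a≢c)

module _ {n : ℕ} .{{_ : NonZero n}} where

  offset : Fin n → Fin n → ℕ
  offset a x = modDiff n (toℕ a) (toℕ x)

  offset<n : ∀ a x → offset a x < n
  offset<n a x = modDiff-< {x = toℕ a} (toℕ<n x)

  offset-relative : ∀ a {x y} → offset a x ≤ offset a y → offset x y ≡ offset a y ∸ offset a x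
  offset-relative a {x} {y} =
    modDiff-relative {q = toℕ a} {toℕ x} {toℕ y} (toℕ<n a) (toℕ<n x) (toℕ<n y)

  ∃-offset≡ : ∀ y {k} → k < n → ∃[ x ] offset x y ≡ k
  ∃-offset≡ y {k} k<n = x , modDiff-unique (toℕ<n x) k<n (begin
    (k + toℕ x) % n                   ≡⟨ cong (λ t → (k + t) % n) (toℕ-fromℕ< x<n) ⟩
    (k + (toℕ y + (n ∸ k)) % n) % n   ≡⟨ [m+n%o]%o≡[m+n]%o k (toℕ y + (n ∸ k)) n ⟩
    (k + (toℕ y + (n ∸ k))) % n       ≡⟨ cong (_% n) (+-comm k (toℕ y + (n ∸ k))) ⟩
    (toℕ y + (n ∸ k) + k) % n         ≡⟨ cong (_% n) (+-assoc (toℕ y) (n ∸ k) k) ⟩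
    (toℕ y + (n ∸ k + k)) % n         ≡⟨ cong (λ t → (toℕ y + t) % n) (m∸n+n≡m (<⇒≤ k<n)) ⟩
    (toℕ y + n) % n                   ≡⟨ [m+n]%n≡m%n (toℕ y) n ⟩
    toℕ y % n                         ≡⟨ m<n⇒m%n≡m (toℕ<n y) ⟩
    toℕ y                             ∎)
    where
    open ≡-Reasoning
    x<n = m%n<n (toℕ y + (n ∸ k)) n
    x = fromℕ< x<n

  -- Opaque, so that a, lo and hi can be inferred from a membership x ∈ arc a lo hi.
  opaque
    arc : Fin n → ℕ → ℕ → Subset n
    arc a lo hi = tabulate (does ∘ λ x → lo ≤? offset a x ×-dec offset a x <? hi)

    ∈-arc⁺ : ∀ {a lo hi x} → lo ≤ offset a x → offset a x < hi → x ∈ arc a lo hi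
    ∈-arc⁺ {a} {lo} {hi} lo≤x x<hi =
      ∈-tabulate⁺ (λ x → lo ≤? offset a x ×-dec offset a x <? hi) (lo≤x , x<hi)

    ∈-arc⁻ : ∀ {a lo hi x} → x ∈ arc a lo hi → lo ≤ offset a x × offset a x < hi
    ∈-arc⁻ {a} {lo} {hi} = ∈-tabulate⁻ (λ x → lo ≤? offset a x ×-dec offset a x <? hi)

  ∉-arc-below : ∀ {a lo hi x} → offset a x < lo → x ∉ arc a lo hi
  ∉-arc-below x<lo x∈ = <⇒≱ x<lo (proj₁ (∈-arc⁻ x∈))

  ∉-arc-above : ∀ {a lo hi x} → hi ≤ offset a x → x ∉ arc a lo hi
  ∉-arc-above hi≤x x∈ = <⇒≱ (proj₂ (∈-arc⁻ x∈)) hi≤x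

  arc-partition3 : ∀ a {i j} → i ≤ j → Partition3 (arc a 0 i) (arc a i j) (arc a j n)
  arc-partition3 a {i} {j} i≤j x with offset a x <? i | offset a x <? j
  ... | yes x<i | _       = inj₁ (∈-arc⁺ z≤n x<i , ∉-arc-below x<i , ∉-arc-below (<-≤-trans x<i i≤j))
  ... | no  x≮i | yes x<j = inj₂ (inj₁ (∉-arc-above (≮⇒≥ x≮i) , ∈-arc⁺ (≮⇒≥ x≮i) x<j , ∉-arc-below x<j))
  ... | no  x≮i | no  x≮j =
    inj₂ (inj₂ (∉-arc-above (≮⇒≥ x≮i) , ∉-arc-above (≮⇒≥ x≮j) , ∈-arc⁺ (≮⇒≥ x≮j) (offset<n a x)))

module Andrasfai (e : ℕ) where

  d : ℕ
  d = suc e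

  n : ℕ
  n = andrasfaiN d

  -- andrasfaiN (suc e) reduces to e + 2 * d.
  n<d+2d : n < d + 2 * d
  n<d+2d = ≤-refl

  0<n : 0 < n
  0<n = <-≤-trans z<s (m≤n+m (2 * d) e)

  instance
    n-nonZero : NonZero n
    n-nonZero = >-nonZero 0<n

  Adj : Fin n → Fin n → Set
  Adj = AndrasfaiAdj d

  Adj-irrefl : ∀ x → ¬ Adj x x
  Adj-irrefl x (d≤xx , _) = <⇒≱ z<s (subst (d ≤_) (modDiff-self (toℕ x)) d≤xx)

  Adj-sym : ∀ {x y} → Adj x y → Adj y x
  Adj-sym {x} {y} adj@(d≤m , m<2d) =
    subst (λ k → d ≤ k × k < 2 * d) (sym offset-yx) (d≤n∸m , n∸m<2d)
    where
    m = offset x y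
    x≢y : toℕ x ≢ toℕ y
    x≢y x≡y = Adj-irrefl x (subst (Adj x) (sym (toℕ-injective x≡y)) adj)
    offset-yx : offset y x ≡ n ∸ m
    offset-yx = trans (sym (m+n∸m≡n m (offset y x)))
                      (cong (_∸ m) (modDiff-+-swap (toℕ<n x) (toℕ<n y) x≢y))
    d≤n∸m : d ≤ n ∸ m
    d≤n∸m = m+n≤o⇒m≤o∸n d (≤-trans (+-monoʳ-≤ d (s≤s⁻¹ m<2d))
                                   (≤-reflexive (sym (+-suc e (e + (d + 0))))))
    n∸m<2d : n ∸ m < 2 * d
    n∸m<2d = m<n+o⇒m∸n<o n m (<-≤-trans n<d+2d (+-monoˡ-≤ (2 * d) d≤m))

  near⇒¬Adj : ∀ (a : Fin n) {x y} → offset a x ≤ offset a y → offset a y < offset a x + d →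
              ¬ Adj x y
  near⇒¬Adj a {x} {y} x≤y y<x+d (d≤xy , _) =
    <⇒≱ (m<n+o⇒m∸n<o (offset a y) (offset a x) y<x+d)
        (subst (d ≤_) (offset-relative a {x} {y} x≤y) d≤xy)

  ¬Adj⇒near : ∀ (a : Fin n) {x y} → offset a x ≤ offset a y → offset a y ∸ offset a x < 2 * d →
              ¬ Adj x y → offset a y < offset a x + d
  ¬Adj⇒near a {x} {y} x≤y gap<2d ¬adj with d ≤? offset a y ∸ offset a x
  ... | yes d≤gap = contradiction
    (subst (λ k → d ≤ k × k < 2 * d) (sym (offset-relative a {x} {y} x≤y)) (d≤gap , gap<2d)) ¬adj
  ... | no  d≰gap =
    subst (_< offset a x + d) (m+[n∸m]≡n x≤y) (+-monoʳ-< (offset a x) (≰⇒> d≰gap))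

  ¬Adj-within : ∀ (a : Fin n) lo {x y} → lo ≤ offset a x → offset a x < lo + d →
                lo ≤ offset a y → offset a y < lo + d → ¬ Adj x y
  ¬Adj-within a lo {x} {y} lo≤x x<hi lo≤y y<hi with ≤-total (offset a x) (offset a y)
  ... | inj₁ x≤y = near⇒¬Adj a x≤y (<-≤-trans y<hi (+-monoˡ-≤ d lo≤x))
  ... | inj₂ y≤x = near⇒¬Adj a y≤x (<-≤-trans x<hi (+-monoˡ-≤ d lo≤y)) ∘ Adj-sym {x} {y}

  arc-independent : ∀ (a : Fin n) {lo hi} → hi ≤ lo + d → Independent Adj (arc a lo hi)
  arc-independent a {lo} hi≤lo+d x y x∈ y∈ =
    ¬Adj-within a lo (proj₁ (∈-arc⁻ x∈)) (<-≤-trans (proj₂ (∈-arc⁻ x∈)) hi≤lo+d)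
                     (proj₁ (∈-arc⁻ y∈)) (<-≤-trans (proj₂ (∈-arc⁻ y∈)) hi≤lo+d)

  non-neighbours-window : ∀ {q p y : Fin n} → offset q p ≡ e → ¬ Adj p y → offset q y < e + d
  non-neighbours-window {q} {p} {y} qp≡e ¬adj with offset q p ≤? offset q y
  ... | no  p≰y = <-≤-trans (subst (offset q y <_) qp≡e (≰⇒> p≰y)) (m≤m+n e d)
  ... | yes p≤y = subst (λ k → offset q y < k + d) qp≡e (¬Adj⇒near q p≤y gap<2d ¬adj)
    where
    gap<2d : offset q y ∸ offset q p < 2 * d
    gap<2d = m<n+o⇒m∸n<o (offset q y) (offset q p)
               (subst (λ k → offset q y < k + 2 * d) (sym qp≡e) (offset<n q y))

  e+d<2d : e + d < 2 * d
  e+d<2d = subst (λ k → e + d < d + k) (sym (+-identityʳ d)) (+-monoˡ-< d (n<1+n e))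

  least⇒⊆arc : ∀ {S : Subset n} {p q a} → Independent Adj S → p ∈ S → offset q p ≡ e →
               a ∈ S → (∀ {y} → y ∈ S → offset q a ≤ offset q y) → S ⊆ arc a 0 d
  least⇒⊆arc {S} {p} {q} {a} independent p∈S qp≡e a∈S least {y} y∈S =
    ∈-arc⁺ z≤n (subst (_< d) (sym (offset-relative q {a} {y} a≤y))
                        (m<n+o⇒m∸n<o (offset q y) (offset q a) y<a+d))
    where
    a≤y = least y∈S
    gap<2d : offset q y ∸ offset q a < 2 * d
    gap<2d = ≤-<-trans (m∸n≤m (offset q y) (offset q a))
               (<-trans (non-neighbours-window {q} {p} {y} qp≡e (independent p y p∈S y∈S)) e+d<2d)
    y<a+d = ¬Adj⇒near q a≤y gap<2d (independent a y a∈S y∈S)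

  independent⊆arc : ∀ {S : Subset n} {p} → Independent Adj S → p ∈ S → ∃[ a ] S ⊆ arc a 0 d
  independent⊆arc {S} {p} independent p∈S =
    let q , qp≡e       = ∃-offset≡ p (m<m+n e z<s)
        a , a∈S , least = ∃-minimiser S (offset q) p∈S
    in  a , least⇒⊆arc {q = q} independent p∈S qp≡e a∈S least

  maximalIndependent≡arc : ∀ {S : Subset n} → MaximalIndependent Adj S → ∃[ a ] S ≡ arc a 0 d
  maximalIndependent≡arc S-maximal@(independent , maximal) =
    let p , p∈S    = maximalIndependent⇒nonempty Adj-irrefl (fromℕ< 0<n) S-maximal
        a , S⊆arc = independent⊆arc independent p∈S
    in  a , ⊆-antisym S⊆arc (maximal (arc a 0 d) (arc-independent a ≤-refl) S⊆arc)

  arc-proper3Coloring : ∀ a → Proper3Coloring Adj (arc a 0 d) (arc a d (2 * d)) (arc a (2 * d) n)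
  arc-proper3Coloring a =
    arc-partition3 a (m≤m+n d (d + 0)) ,
    arc-independent a ≤-refl ,
    arc-independent a (≤-reflexive (cong (d +_) (+-identityʳ d))) ,
    arc-independent a (≤-trans (<⇒≤ n<d+2d) (≤-reflexive (+-comm d (2 * d))))

  ComplAdj-sym : ∀ {x y} → ComplAdj Adj x y → ComplAdj Adj y x
  ComplAdj-sym {x} {y} (x≢y , ¬adj) = x≢y ∘ sym , ¬adj ∘ Adj-sym {y} {x}

  complement-near : ∀ (a : Fin n) {u v} → d ≤ offset a u → offset a u ≤ offset a v → ¬ Adj u v →
                    offset a v < offset a u + d
  complement-near a {u} {v} d≤u u≤v = ¬Adj⇒near a u≤v (m<n+o⇒m∸n<o (offset a v) (offset a u)
    (<-≤-trans (<-trans (offset<n a v) n<d+2d) (+-monoˡ-≤ (2 * d) d≤u)))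

  complement-upperCliques : ∀ (a : Fin n) {S} → (∀ {x} → x ∈ S → d ≤ offset a x) →
                            UpperNeighbourhoodsAreCliques (ComplAdj Adj) S (offset a)
  complement-upperCliques a above {m} m∈S (_ , ¬mv) (_ , ¬mz) m≤v m≤z v≢z =
    v≢z , ¬Adj-within a (offset a m) m≤v (complement-near a (above m∈S) m≤v ¬mv)
                                     m≤z (complement-near a (above m∈S) m≤z ¬mz)

  upperArcs-¬HasInducedC4 : ∀ a → ¬ HasInducedC4 (ComplAdj Adj) (arc a d (2 * d) ∪ arc a (2 * d) n)
  upperArcs-¬HasInducedC4 a =
    upperCliques⇒¬HasInducedC4 ComplAdj-sym (complement-upperCliques a above)
    where
    above : ∀ {x} → x ∈ arc a d (2 * d) ∪ arc a (2 * d) n → d ≤ offset a x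
    above {x} x∈ with x∈p∪q⁻ (arc a d (2 * d)) (arc a (2 * d) n) x∈
    ... | inj₁ x∈D₂ = proj₁ (∈-arc⁻ x∈D₂)
    ... | inj₂ x∈D₃ = ≤-trans (m≤m+n d (d + 0)) (proj₁ (∈-arc⁻ x∈D₃))

  arc-colouring : ∀ {D₁ : Subset n} → ∃[ a ] D₁ ≡ arc a 0 d →
                  ∃[ D₂ ] ∃[ D₃ ] (Proper3Coloring Adj D₁ D₂ D₃ × ¬ HasInducedC4 (ComplAdj Adj) (D₂ ∪ D₃))
  arc-colouring (a , refl) =
    arc a d (2 * d) , arc a (2 * d) n , arc-proper3Coloring a , upperArcs-¬HasInducedC4 a

lemma11 : (d : ℕ) → 1 ≤ d →
    (D₁ : Subset (andrasfaiN d)) → MaximalIndependent (AndrasfaiAdj d) D₁ →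
    ∃[ D₂ ] ∃[ D₃ ]
      (Proper3Coloring (AndrasfaiAdj d) D₁ D₂ D₃ ×
       ¬ HasInducedC4 (ComplAdj (AndrasfaiAdj d)) (D₂ ∪ D₃))
lemma11 (suc e) _ D₁ maximal = arc-colouring (maximalIndependent≡arc maximal)
  where open Andrasfai e
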